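{- Let $t,p$ be positive integers, $N=\lfloor\frac{t+p-2}{p}\rfloor$, and $1\leq r\leq N$. For $1\leq k\leq N$ let $a_k=t-(k-1)p-1$. Let $c_1,\ldots,c_r$ be positive integers with $c_k\leq a_k$ for $1\leq k\leq r$, and let $\mu_{c_1,\ldots,c_r}$ be the partition whose $\beta$-set is \[ \beta(\mu_{c_1,\ldots,c_r})=\bigcup_{k=1}^{r}\{x\in\mathbb{Z}: kt-c_k\leq x\leq kt-1\}. \] Then $\mu_{c_1,\ldots,c_r}$ is a $(t,t+1,\ldots,t+p)$-core partition if and only if $c_k-c_{k+1}\geq p$ for all $1\leq k\leq r-1$.
   Context: A partition $\lambda=(\lambda_1,\ldots,\lambda_r)$ is a finite weakly decreasing sequence of positive integers. In its Young diagram, the hook length $h(i,j)$ of box $(i,j)$ is the number of boxes directly to its right, directly below it, plus the box itself. $\lambda$ is a $t$-core partition if no hook length is divisible by $t$, and a $(t_1,\ldots,t_m)$-core partition if it is a $t_i$-core for all $i$. The $\beta$-set of $\lambda$ is $\beta(\lambda)=\{h(i,1):1\leq i\leq r\}$; every finite set of positive integers is the $\beta$-set of a unique partition. -}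

module Defs where

open import Data.Nat using (ℕ; zero; suc; _+_; _*_; _∸_; _≤_; _<_; _<?_)
open import Data.Nat.DivMod using (_/_)
open import Data.Nat.Divisibility using (_∣_)
open import Data.List using (List; length; lookup; filter)
open import Data.List.Relation.Unary.All using (All)
open import Data.List.Relation.Unary.Linked using (Linked)
open import Data.Fin using (Fin; toℕ)
open import Data.Product using (Σ; ∃; _×_)
open import Relation.Nullary using (¬_)
open import Relation.Binary.PropositionalEquality using (_≡_)
open import Data.Nat using (_≥_)

-- A partition: a finite weakly decreasing list of positive integers
-- (λ₁ ≥ λ₂ ≥ … ≥ λᵣ > 0).  Rows are 0-indexed by Fin (length parts).
record Partition : Set where
  constructor mkPartition
  field
    parts      : List ℕ
    positive   : All (λ x → 1 ≤ x) parts
    decreasing : Linked _≥_ parts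
open Partition public

len : Partition → ℕ
len μ = length (parts μ)

part : (μ : Partition) → Fin (len μ) → ℕ
part μ i = lookup (parts μ) i

colLen : Partition → ℕ → ℕ
colLen μ j = length (filter (j <?_) (parts μ))

-- hook length of box (i , j) (0-indexed), valid when j < part μ i:
-- arm (boxes to the right) + leg (boxes below) + 1
hook : (μ : Partition) → Fin (len μ) → ℕ → ℕ
hook μ i j = (part μ i ∸ suc j) + (colLen μ j ∸ suc (toℕ i)) + 1

IsCore : ℕ → Partition → Set
IsCore t μ = (i : Fin (len μ)) (j : ℕ) → j < part μ i → ¬ (t ∣ hook μ i j)

IsCoreRange : ℕ → ℕ → Partition → Set
IsCoreRange t p μ = (s : ℕ) → t ≤ s → s ≤ t + p → IsCore s μ

_∈β_ : ℕ → Partition → Set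
x ∈β μ = Σ (Fin (len μ)) (λ i → hook μ i 0 ≡ x)

-- N = ⌊(t + p - 2) / p⌋  (p ≥ 1; the p = 0 case is never used)
Nbound : ℕ → ℕ → ℕ
Nbound t zero    = 0
Nbound t (suc q) = (t + suc q ∸ 2) / suc q

aSeq : ℕ → ℕ → ℕ → ℕ
aSeq t p k = t ∸ (k ∸ 1) * p ∸ 1

inMuSet : ℕ → ℕ → (ℕ → ℕ) → ℕ → Set
inMuSet t r c x = ∃ λ k → 1 ≤ k × k ≤ r × (k * t ∸ c k ≤ x) × (x < k * t)

module Submission where

-- The hook lengths of
--     μ are exactly the positive differences x - y with x ∈ β(μ) and
--     y ∉ β(μ): the box (i, j) corresponds to the gap y = n + j - colLen j
--     below the first-column hook of row i, and conversely (hook-gap and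
--     gap-hook).
--
-- (2) Arithmetic of the set S = ⋃_k [k t - c_k, k t - 1].  If the c_k
--     decrease in steps of at least p, then for x ∈ S and y ∉ S with
--     x = h + y there is m with m(t+p) < h < (m+1) t, so no s ∈ [t, t+p]
--     divides h (spaced⇒noDivisibleDistance).  If the spacing fails at k,
--     the number just below block k and a point of block k+1 are at a
--     distance h ∈ [t, t+p] (spacingFailure⇒distance).
--
-- The theorem follows by transporting between β(μ) and S.

open import Defs
import Data.List as L
open import Data.List using (List; []; _∷_; length; lookup; filter)
open import Data.List.Relation.Unary.All using (All; _∷_)
open import Data.List.Relation.Unary.Linked as Linked using (Linked; _∷_)
import Data.List.Properties as LP
open import Data.Nat
open import Data.Nat.Properties
open import Data.Nat.DivMod using (_/_; _%_; m≡m%n+[m/n]*n; m%n<n)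
open import Data.Nat.Divisibility using (_∣_; divides; ∣-refl)
open import Data.Nat.Tactic.RingSolver using (solve; solve-∀)
open import Algebra.Properties.CommutativeSemigroup +-commutativeSemigroup
  using (xy∙z≈y∙xz; xy∙z≈xz∙y)
open import Data.Fin using (Fin; toℕ; fromℕ<)
import Data.Fin as Fin
open import Data.Fin.Properties using (toℕ<n; toℕ-fromℕ<)
open import Data.Product using (∃; ∃₂; _×_; _,_; proj₁; proj₂)
open import Data.Sum using (inj₁; inj₂)
open import Relation.Nullary using (¬_; Dec; yes; no; contradiction)
open import Relation.Binary.PropositionalEquality
open import Relation.Binary.Definitions using (tri<; tri≈; tri>)
open import Function.Base using (_∘_)
open import Function.Bundles using (_⇔_; mk⇔; Equivalence)

-- A decidable, downward closed predicate on [0, n) holds exactly on an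
-- initial segment [0, l).  Used to count the β-numbers above a gap.
initialSegment : (P : ℕ → Set) → (∀ m → Dec (P m)) → (n : ℕ) →
  (∀ m m' → m ≤ m' → m' < n → P m' → P m) →
  ∃ λ l → l ≤ n × (∀ m → m < n → (P m → m < l) × (m < l → P m))
initialSegment P P? zero closed = 0 , z≤n , λ m ()
initialSegment P P? (suc n) closed with P? n
... | yes Pn = suc n , ≤-refl , λ m m<1+n →
      (λ _ → m<1+n) , (λ _ → closed m n (s≤s⁻¹ m<1+n) ≤-refl Pn)
... | no ¬Pn with initialSegment P P? n (λ m m' m≤m' m'<n → closed m m' m≤m' (m<n⇒m<1+n m'<n))
... | l , l≤n , segment = l , m≤n⇒m≤1+n l≤n , extend
  where
  extend : ∀ m → m < suc n → (P m → m < l) × (m < l → P m)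
  extend m m<1+n with m≤n⇒m<n∨m≡n (s≤s⁻¹ m<1+n)
  ... | inj₁ m<n = segment m m<n
  ... | inj₂ refl = (λ Pn → contradiction Pn ¬Pn) , (λ n<l → contradiction l≤n (<⇒≱ n<l))

rowAt : List ℕ → ℕ → ℕ
rowAt []       _       = 0
rowAt (a ∷ _)  zero    = a
rowAt (_ ∷ ps) (suc m) = rowAt ps m

columnLength : List ℕ → ℕ → ℕ
columnLength ps j = length (filter (j <?_) ps)

lookup≡rowAt : ∀ ps (i : Fin (length ps)) → lookup ps i ≡ rowAt ps (toℕ i)
lookup≡rowAt (a ∷ ps) Fin.zero    = refl
lookup≡rowAt (a ∷ ps) (Fin.suc i) = lookup≡rowAt ps i

rowAt≤head : ∀ a ps → Linked _≥_ (a ∷ ps) → ∀ m → rowAt (a ∷ ps) m ≤ a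
rowAt≤head a ps       _            zero    = ≤-refl
rowAt≤head a []       _            (suc m) = z≤n
rowAt≤head a (b ∷ ps) (a≥b ∷ desc) (suc m) = ≤-trans (rowAt≤head b ps desc m) a≥b

rowAt-antitone : ∀ ps → Linked _≥_ ps → ∀ {m m'} → m ≤ m' → rowAt ps m' ≤ rowAt ps m
rowAt-antitone []       desc _                  = z≤n
rowAt-antitone (a ∷ ps) desc {zero} {m'} _     = rowAt≤head a ps desc m'
rowAt-antitone (a ∷ ps) desc {suc m} (s≤s m≤m') = rowAt-antitone ps (Linked.tail desc) m≤m'

rowAt-positive : ∀ ps → All (1 ≤_) ps → ∀ m → m < length ps → 1 ≤ rowAt ps m
rowAt-positive (a ∷ ps) (1≤a ∷ _)   zero    _         = 1≤a
rowAt-positive (a ∷ ps) (_   ∷ pos) (suc m) (s≤s m<n) = rowAt-positive ps pos m m<n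

rowAt-beyond : ∀ ps m → length ps ≤ m → rowAt ps m ≡ 0
rowAt-beyond []       m       _           = refl
rowAt-beyond (a ∷ ps) (suc m) (s≤s len≤m) = rowAt-beyond ps m len≤m

columnLength-spec : ∀ ps → Linked _≥_ ps → ∀ j m →
  (j < rowAt ps m → m < columnLength ps j) × (m < columnLength ps j → j < rowAt ps m)
columnLength-spec []       desc j m = (λ ()) , (λ ())
columnLength-spec (a ∷ ps) desc j m with j <? a
columnLength-spec (a ∷ ps) desc j zero | yes j<a
  rewrite LP.filter-accept (j <?_) {xs = ps} j<a = (λ _ → z<s) , (λ _ → j<a)
columnLength-spec (a ∷ ps) desc j (suc m) | yes j<a
  rewrite LP.filter-accept (j <?_) {xs = ps} j<a =
    (s≤s ∘ proj₁ rest) , (proj₂ rest ∘ s≤s⁻¹)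
  where
  rest : (j < rowAt ps m → m < columnLength ps j) × (m < columnLength ps j → j < rowAt ps m)
  rest = columnLength-spec ps (Linked.tail desc) j m
columnLength-spec (a ∷ ps) desc j m | no j≮a
  rewrite LP.filter-reject (j <?_) {xs = ps} j≮a =
    (λ j<row → contradiction (<-≤-trans j<row (rowAt≤head a ps desc m)) j≮a) ,
    (λ m<col → contradiction
      (<-≤-trans (proj₂ (columnLength-spec ps (Linked.tail desc) j 0) (≤-<-trans z≤n m<col))
                 (rowAt≤head a ps desc 1))
      j≮a)

module YoungDiagram
  (row : ℕ → ℕ) (n : ℕ) (col : ℕ → ℕ)
  (row-antitone : ∀ {m m'} → m ≤ m' → row m' ≤ row m)
  (row-positive : ∀ m → m < n → 1 ≤ row m)
  (row-beyond : ∀ m → n ≤ m → row m ≡ 0)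
  (col-spec : ∀ j m → (j < row m → m < col j) × (m < col j → j < row m))
  where

  hookAt : ℕ → ℕ → ℕ
  hookAt i j = (row i ∸ suc j) + (col j ∸ suc i) + 1

  -- The β-number of row m: its first-column hook length.
  beta : ℕ → ℕ
  beta m = row m + (n ∸ suc m)

  gapOf : ℕ → ℕ
  gapOf j = n + j ∸ col j

  beta-spec : ∀ {m} → m < n → beta m + suc m ≡ row m + n
  beta-spec {m} m<n = trans (+-assoc (row m) _ _) (cong (row m +_) (m∸n+n≡m m<n))

  beta-antitone : ∀ {m m'} → m ≤ m' → m' < n → beta m' + m' ≤ beta m + m
  beta-antitone {m} {m'} m≤m' m'<n = s≤s⁻¹ (begin
    suc (beta m' + m')   ≡⟨ sym (+-suc (beta m') m') ⟩
    beta m' + suc m'     ≡⟨ beta-spec m'<n ⟩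
    row m' + n           ≤⟨ +-monoˡ-≤ n (row-antitone m≤m') ⟩
    row m + n            ≡⟨ sym (beta-spec (≤-<-trans m≤m' m'<n)) ⟩
    beta m + suc m       ≡⟨ +-suc (beta m) m ⟩
    suc (beta m + m)     ∎)
    where open ≤-Reasoning

  col-unique : ∀ j l → (∀ m → (j < row m → m < l) × (m < l → j < row m)) → col j ≡ l
  col-unique j l spec with <-cmp (col j) l
  ... | tri< c<l _ _ = contradiction (proj₁ (col-spec j (col j)) (proj₂ (spec (col j)) c<l)) (n≮n _)
  ... | tri≈ _ c≡l _ = c≡l
  ... | tri> _ _ l<c = contradiction (proj₁ (spec l) (proj₂ (col-spec j l) l<c)) (n≮n _)

  col≤n : ∀ j → col j ≤ n
  col≤n j = ≮⇒≥ λ n<col → contradiction (proj₂ (col-spec j n) n<col) (λ j<row →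
    contradiction (subst (j <_) (row-beyond n ≤-refl) j<row) λ ())

  gapOf-spec : ∀ j → gapOf j + col j ≡ n + j
  gapOf-spec j = m∸n+n≡m (≤-trans (col≤n j) (m≤m+n n j))

  -- Rearrangement behind hook-from-gap, with A = row i - (j+1) and
  -- B = col j - (i+1).
  private
    hookArith : ∀ A B y i j → y + (B + suc i) ≡ n + j → A + B + 1 + y + suc i ≡ A + suc j + n
    hookArith A B y i j e = begin
      A + B + 1 + y + suc i   ≡⟨ solve (A L.∷ B L.∷ y L.∷ i L.∷ L.[]) ⟩
      A + 1 + (y + (B + suc i)) ≡⟨ cong (A + 1 +_) e ⟩
      A + 1 + (n + j)         ≡⟨ solve (A L.∷ n L.∷ j L.∷ L.[]) ⟩
      A + suc j + n           ∎
      where open ≡-Reasoning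

  hook-from-gap : ∀ {i j y} → i < n → j < row i → i < col j → y + col j ≡ n + j →
    hookAt i j + y ≡ beta i
  hook-from-gap {i} {j} {y} i<n j<row i<col e = +-cancelʳ-≡ (suc i) _ _ (begin
    hookAt i j + y + suc i  ≡⟨ hookArith (row i ∸ suc j) (col j ∸ suc i) y i j
                                 (trans (cong (y +_) (m∸n+n≡m i<col)) e) ⟩
    row i ∸ suc j + suc j + n ≡⟨ cong (_+ n) (m∸n+n≡m j<row) ⟩
    row i + n               ≡⟨ sym (beta-spec i<n) ⟩
    beta i + suc i          ∎)
    where open ≡-Reasoning

  -- The gap of a column is not a β-number: rows reaching column j have
  -- β-numbers above it, the other rows have β-numbers below it.
  gapOf-notBeta : ∀ j m → m < n → beta m ≢ gapOf j
  gapOf-notBeta j m m<n β≡gap with m <? col j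
  ... | yes m<col = n≮n (gapOf j + col j) (begin-strict
        gapOf j + col j  ≡⟨ gapOf-spec j ⟩
        n + j            <⟨ +-monoʳ-< n (n<1+n j) ⟩
        n + suc j        ≡⟨ +-comm n _ ⟩
        suc j + n        ≤⟨ +-monoˡ-≤ n (proj₂ (col-spec j m) m<col) ⟩
        row m + n        ≡⟨ sym (beta-spec m<n) ⟩
        beta m + suc m   ≤⟨ +-monoʳ-≤ (beta m) m<col ⟩
        beta m + col j   ≡⟨ cong (_+ col j) β≡gap ⟩
        gapOf j + col j  ∎)
    where open ≤-Reasoning
  ... | no m≮col = n≮n (gapOf j + m) (begin-strict
        gapOf j + m      ≡⟨ cong (_+ m) (sym β≡gap) ⟩
        beta m + m       <⟨ +-monoʳ-< (beta m) (n<1+n m) ⟩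
        beta m + suc m   ≡⟨ beta-spec m<n ⟩
        row m + n        ≤⟨ +-monoˡ-≤ n (≮⇒≥ (m≮col ∘ proj₁ (col-spec j m))) ⟩
        j + n            ≡⟨ +-comm j n ⟩
        n + j            ≡⟨ sym (gapOf-spec j) ⟩
        gapOf j + col j  ≤⟨ +-monoʳ-≤ (gapOf j) (≮⇒≥ m≮col) ⟩
        gapOf j + m      ∎)
    where open ≤-Reasoning

  box⇒gap : ∀ i j → i < n → j < row i →
    hookAt i j + gapOf j ≡ beta i × (∀ m → m < n → beta m ≢ gapOf j)
  box⇒gap i j i<n j<row =
    hook-from-gap i<n j<row (proj₁ (col-spec j i) j<row) (gapOf-spec j) , gapOf-notBeta j

  -- For the converse, let the β-numbers above a gap y be those of rows
  -- 0..l-1, and put j = y + l - n.  Then rows 0..l-1 reach column j ...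
  rows-reach-column : ∀ {y l j} → l ≤ n → (∀ m → m < l → y < beta m) →
    j + n ≡ y + l → ∀ m → m < l → j < row m
  rows-reach-column {y} {suc l'} {j} l≤n above eq m m<l = +-cancelʳ-≤ n _ _ (begin
    suc j + n            ≡⟨ cong suc eq ⟩
    suc (y + suc l')     ≡⟨ cong suc (+-suc y l') ⟩
    suc (suc y + l')     ≤⟨ s≤s (+-monoˡ-≤ l' (above l' ≤-refl)) ⟩
    suc (beta l' + l')   ≤⟨ s≤s (beta-antitone (s≤s⁻¹ m<l) l≤n) ⟩
    suc (beta m + m)     ≡⟨ sym (+-suc (beta m) m) ⟩
    beta m + suc m       ≡⟨ beta-spec (<-≤-trans m<l l≤n) ⟩
    row m + n            ∎)
    where open ≤-Reasoning

  column-rows-only : ∀ {y l j} → (∀ m → m < n → y < beta m → m < l) →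
    (∀ m → m < n → beta m ≢ y) → j + n ≡ y + l → ∀ m → j < row m → m < l
  column-rows-only {y} {l} {j} above notBeta eq m j<row with m <? l | m <? n
  ... | yes m<l | _       = m<l
  ... | no _    | no m≮n  = contradiction (subst (j <_) (row-beyond m (≮⇒≥ m≮n)) j<row) λ ()
  ... | no m≮l  | yes m<n = contradiction j<row (≤⇒≯ (+-cancelʳ-≤ n _ _ (begin
    row m + n            ≡⟨ sym (beta-spec m<n) ⟩
    beta m + suc m       ≡⟨ +-suc (beta m) m ⟩
    suc (beta m + m)     ≤⟨ s≤s (beta-antitone (≮⇒≥ m≮l) m<n) ⟩
    suc (beta l + l)     ≤⟨ +-monoˡ-≤ l βl<y ⟩
    y + l                ≡⟨ sym eq ⟩
    j + n                ∎)))
    where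
    open ≤-Reasoning
    l<n : l < n
    l<n = ≤-<-trans (≮⇒≥ m≮l) m<n
    βl<y : beta l < y
    βl<y = ≤∧≢⇒< (≮⇒≥ (λ y<βl → n≮n l (above l l<n y<βl))) (notBeta l l<n)

  gap⇒box : ∀ i y → i < n → y < beta i → (∀ m → m < n → beta m ≢ y) →
    ∃ λ j → j < row i × hookAt i j + y ≡ beta i
  gap⇒box i y i<n y<βi notBeta
    with initialSegment (λ m → y < beta m) (λ m → y <? beta m) n
           (λ m m' m≤m' m'<n y<βm' → <-≤-trans y<βm'
              (+-cancelʳ-≤ m' _ _ (≤-trans (beta-antitone m≤m' m'<n) (+-monoʳ-≤ (beta m) m≤m'))))
  ... | l , l≤n , segment = j , reaches i i<l , hook-from-gap i<n (reaches i i<l) i<col gap-eq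
    where
    i<l : i < l
    i<l = proj₁ (segment i i<n) y<βi
    n≤y+l : n ≤ y + l
    n≤y+l with m≤n⇒m<n∨m≡n l≤n
    ... | inj₂ l≡n = subst (_≤ y + l) l≡n (m≤n+m l y)
    ... | inj₁ l<n = s≤s⁻¹ (begin
          suc n            ≤⟨ +-monoˡ-≤ n (row-positive l l<n) ⟩
          row l + n        ≡⟨ sym (beta-spec l<n) ⟩
          beta l + suc l   <⟨ +-monoˡ-< (suc l) βl<y ⟩
          y + suc l        ≡⟨ +-suc y l ⟩
          suc (y + l)      ∎)
      where
      open ≤-Reasoning
      βl<y : beta l < y
      βl<y = ≤∧≢⇒< (≮⇒≥ (λ y<βl → n≮n l (proj₁ (segment l l<n) y<βl))) (notBeta l l<n)
    j : ℕ
    j = y + l ∸ n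
    j-eq : j + n ≡ y + l
    j-eq = m∸n+n≡m n≤y+l
    reaches : ∀ m → m < l → j < row m
    reaches = rows-reach-column l≤n (λ m m<l → proj₂ (segment m (<-≤-trans m<l l≤n)) m<l) j-eq
    col≡l : col j ≡ l
    col≡l = col-unique j l λ m →
      column-rows-only (λ m m<n → proj₁ (segment m m<n)) notBeta j-eq m , reaches m
    i<col : i < col j
    i<col = subst (i <_) (sym col≡l) i<l
    gap-eq : y + col j ≡ n + j
    gap-eq = trans (cong (y +_) col≡l) (trans (sym j-eq) (+-comm j n))

module _ (μ : Partition) where
  private
    ps = parts μ
    desc = decreasing μ
  open YoungDiagram (rowAt ps) (len μ) (columnLength ps)
    (rowAt-antitone ps desc) (rowAt-positive ps (positive μ)) (rowAt-beyond ps)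
    (columnLength-spec ps desc)

  private
    hook≡hookAt : ∀ i j → hook μ i j ≡ hookAt (toℕ i) j
    hook≡hookAt i j = cong (λ a → (a ∸ suc j) + (columnLength ps j ∸ suc (toℕ i)) + 1)
                           (lookup≡rowAt ps i)

    -- All parts are positive, so column 0 has length len μ.
    firstHook≡beta : ∀ i → hook μ i 0 ≡ beta (toℕ i)
    firstHook≡beta i = begin
      hook μ i 0                                          ≡⟨ cong₂ (λ a b → (a ∸ 1) + (b ∸ suc (toℕ i)) + 1)
                                                               (lookup≡rowAt ps i) column₀ ⟩
      (rowAt ps (toℕ i) ∸ 1) + (len μ ∸ suc (toℕ i)) + 1  ≡⟨ pred+1 (rowAt-positive ps (positive μ) (toℕ i) (toℕ<n i)) ⟩
      beta (toℕ i)                                        ∎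
      where
      open ≡-Reasoning
      column₀ : columnLength ps 0 ≡ len μ
      column₀ = cong length (LP.filter-all (0 <?_) (positive μ))
      pred+1 : ∀ {a b} → 1 ≤ a → (a ∸ 1) + b + 1 ≡ a + b
      pred+1 {suc a} {b} _ = +-comm (a + b) 1

    notBeta : ∀ {y} → ¬ (y ∈β μ) → ∀ m → m < len μ → beta m ≢ y
    notBeta y∉β m m<n βm≡y =
      y∉β (fromℕ< m<n , trans (firstHook≡beta _) (trans (cong beta (toℕ-fromℕ< m<n)) βm≡y))

  hook-gap : ∀ i j → j < part μ i → ∃ λ y → ¬ (y ∈β μ) × (hook μ i j + y) ∈β μ
  hook-gap i j j<part = gapOf j , gap∉β , (i , firstHook≡hook+gap)
    where
    box : hookAt (toℕ i) j + gapOf j ≡ beta (toℕ i) × (∀ m → m < len μ → beta m ≢ gapOf j)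
    box = box⇒gap (toℕ i) j (toℕ<n i) (subst (j <_) (lookup≡rowAt ps i) j<part)
    gap∉β : ¬ (gapOf j ∈β μ)
    gap∉β (i' , eq) = proj₂ box (toℕ i') (toℕ<n i') (trans (sym (firstHook≡beta i')) eq)
    firstHook≡hook+gap : hook μ i 0 ≡ hook μ i j + gapOf j
    firstHook≡hook+gap = trans (firstHook≡beta i)
      (sym (trans (cong (_+ gapOf j) (hook≡hookAt i j)) (proj₁ box)))

  gap-hook : ∀ {y h} → ¬ (y ∈β μ) → 1 ≤ h → (h + y) ∈β μ →
    ∃₂ λ i j → j < part μ i × hook μ i j ≡ h
  gap-hook {y} {h} y∉β 1≤h (i , firstHook≡h+y) =
    i , proj₁ box , subst (proj₁ box <_) (sym (lookup≡rowAt ps i)) (proj₁ (proj₂ box)) , hook≡h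
    where
    β≡h+y : beta (toℕ i) ≡ h + y
    β≡h+y = trans (sym (firstHook≡beta i)) firstHook≡h+y
    y<β : y < beta (toℕ i)
    y<β = subst (y <_) (sym β≡h+y) (+-monoˡ-≤ y 1≤h)
    box : ∃ λ j → j < rowAt ps (toℕ i) × hookAt (toℕ i) j + y ≡ beta (toℕ i)
    box = gap⇒box (toℕ i) y (toℕ<n i) y<β (notBeta y∉β)
    hook≡h : hook μ i (proj₁ box) ≡ h
    hook≡h = trans (hook≡hookAt i (proj₁ box))
      (+-cancelʳ-≡ y _ _ (trans (proj₂ (proj₂ box)) β≡h+y))

Spaced : ℕ → ℕ → (ℕ → ℕ) → Set
Spaced p r c = ∀ k → 1 ≤ k → k ≤ r ∸ 1 → p + c (suc k) ≤ c k

-- The lower bound k t - c_k ≤ x of a block, without truncated subtraction.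
∸≤⇒≤+ : ∀ {a b x} → a ∸ b ≤ x → a ≤ x + b
∸≤⇒≤+ {a} {b} {x} le = ≤-trans (m≤n+m∸n a b) (subst (b + (a ∸ b) ≤_) (+-comm b x) (+-monoʳ-≤ b le))

≤+⇒∸≤ : ∀ {a b x} → a ≤ x + b → a ∸ b ≤ x
≤+⇒∸≤ {a} {b} {x} le = m≤n+o⇒m∸n≤o a b (subst (a ≤_) (+-comm x b) le)

spaced-iterate : ∀ {p r c} → Spaced p r c → ∀ a m → 1 ≤ a → a + m ≤ r → m * p + c (a + m) ≤ c a
spaced-iterate {p} {r} {c} spaced a zero    1≤a _ = ≤-reflexive (cong c (+-identityʳ a))
spaced-iterate {p} {r} {c} spaced a (suc m) 1≤a a+m<r = begin
  suc m * p + c (a + suc m)        ≡⟨ cong (λ v → suc m * p + c v) (+-suc a m) ⟩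
  p + m * p + c (suc (a + m))      ≡⟨ xy∙z≈y∙xz p (m * p) (c (suc (a + m))) ⟩
  m * p + (p + c (suc (a + m)))    ≤⟨ +-monoʳ-≤ (m * p) (spaced (a + m) (≤-trans 1≤a (m≤m+n a m))
                                        (∸-monoˡ-≤ 1 (subst (_≤ r) (+-suc a m) a+m<r))) ⟩
  m * p + c (a + m)                ≤⟨ spaced-iterate spaced a m 1≤a (≤-trans (+-monoʳ-≤ a (n≤1+n m)) a+m<r) ⟩
  c a                              ∎
  where open ≤-Reasoning

noMultipleBetween : ∀ {t p s h} m → m * (t + p) < h → h < suc m * t →
  t ≤ s → s ≤ t + p → ¬ s ∣ h
noMultipleBetween {t} {p} {s} m lo hi t≤s s≤t+p (divides w refl) with w ≤? m
... | yes w≤m = n≮n (w * s) (begin-strict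
      w * s        ≤⟨ *-monoˡ-≤ s w≤m ⟩
      m * s        ≤⟨ *-monoʳ-≤ m s≤t+p ⟩
      m * (t + p)  <⟨ lo ⟩
      w * s        ∎)
  where open ≤-Reasoning
... | no w≰m = n≮n (w * s) (begin-strict
      w * s        <⟨ hi ⟩
      suc m * t    ≤⟨ *-monoˡ-≤ t (≰⇒> w≰m) ⟩
      w * t        ≤⟨ *-monoʳ-≤ w t≤s ⟩
      w * s        ∎)
  where open ≤-Reasoning

-- The estimate behind gapDistance: y = ρ + q t lies below block q+1 (so
-- ρ + c_{q+1} < t) and x = h + y lies in block q+1+m.
distanceBounds : ∀ t p h ρ q m c₁ cₖ → ρ + c₁ < t → m * p + cₖ ≤ c₁ →
  (suc q + m) * t ≤ h + (ρ + q * t) + cₖ → h + (ρ + q * t) < (suc q + m) * t →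
  m * (t + p) < h × h < suc m * t
distanceBounds t p h ρ q m c₁ cₖ ρ+c₁<t spacing lower upper = below , above
  where
  open ≤-Reasoning
  block≡ : (suc q + m) * t ≡ t + m * t + q * t
  block≡ = solve (q L.∷ m L.∷ t L.∷ L.[])
  below : m * (t + p) < h
  below = +-cancelʳ-< (ρ + q * t + cₖ) _ _ (begin-strict
    m * (t + p) + (ρ + q * t + cₖ)    ≡⟨ solve (m L.∷ t L.∷ p L.∷ ρ L.∷ q L.∷ cₖ L.∷ L.[]) ⟩
    ρ + (m * p + cₖ) + m * t + q * t  ≤⟨ +-monoˡ-≤ (q * t) (+-monoˡ-≤ (m * t) (+-monoʳ-≤ ρ spacing)) ⟩
    ρ + c₁ + m * t + q * t            <⟨ +-monoˡ-< (q * t) (+-monoˡ-< (m * t) ρ+c₁<t) ⟩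
    t + m * t + q * t                 ≡⟨ sym block≡ ⟩
    (suc q + m) * t                   ≤⟨ lower ⟩
    h + (ρ + q * t) + cₖ              ≡⟨ solve (h L.∷ ρ L.∷ q L.∷ t L.∷ cₖ L.∷ L.[]) ⟩
    h + (ρ + q * t + cₖ)              ∎)
  above : h < suc m * t
  above = +-cancelʳ-< (q * t) _ _ (begin-strict
    h + q * t              ≤⟨ +-monoˡ-≤ (q * t) (m≤m+n h ρ) ⟩
    h + ρ + q * t          ≡⟨ +-assoc h ρ (q * t) ⟩
    h + (ρ + q * t)        <⟨ upper ⟩
    (suc q + m) * t        ≡⟨ block≡ ⟩
    suc m * t + q * t      ∎)

gapDistance : ∀ {t} .{{_ : NonZero t}} {p r c} → Spaced p r c →
  ∀ {x y h} → inMuSet t r c x → ¬ inMuSet t r c y → h + y ≡ x →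
  ∃ λ m → m * (t + p) < h × h < suc m * t
gapDistance {t} {p} {r} {c} spaced {x} {y} {h} (k , 1≤k , k≤r , lo , hi) y∉S h+y≡x
  with y / t <? k
... | no q≮k = contradiction hi (≤⇒≯ (begin
      k * t              ≤⟨ *-monoˡ-≤ t (≮⇒≥ q≮k) ⟩
      y / t * t          ≤⟨ m≤n+m (y / t * t) (y % t) ⟩
      y % t + y / t * t  ≡⟨ sym (m≡m%n+[m/n]*n y t) ⟩
      y                  ≤⟨ m≤n+m y h ⟩
      h + y              ≡⟨ h+y≡x ⟩
      x                  ∎))
  where open ≤-Reasoning
... | yes q<k with m≤n⇒∃[o]m+o≡n q<k
... | m , refl =
  m , distanceBounds t p h ρ q m (c (suc q)) (c (suc q + m)) ρ+c₁<t
        (spaced-iterate spaced (suc q) m z<s k≤r)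
        (subst (λ v → (suc q + m) * t ≤ h + v + c (suc q + m)) y≡
          (subst (λ v → (suc q + m) * t ≤ v + c (suc q + m)) (sym h+y≡x) (∸≤⇒≤+ lo)))
        (subst (λ v → h + v < (suc q + m) * t) y≡ (subst (_< (suc q + m) * t) (sym h+y≡x) hi))
  where
  q ρ : ℕ
  q = y / t
  ρ = y % t
  y≡ : y ≡ ρ + q * t
  y≡ = m≡m%n+[m/n]*n y t
  y<next : y < suc q * t
  y<next = subst (_< t + q * t) (sym y≡) (+-monoˡ-< (q * t) (m%n<n y t))
  ρ+c₁<t : ρ + c (suc q) < t
  ρ+c₁<t = +-cancelʳ-< (q * t) _ _ (begin-strict
    ρ + c (suc q) + q * t  ≡⟨ xy∙z≈xz∙y ρ (c (suc q)) (q * t) ⟩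
    ρ + q * t + c (suc q)  ≡⟨ cong (_+ c (suc q)) (sym y≡) ⟩
    y + c (suc q)          <⟨ ≰⇒> (λ next≤ → y∉S (suc q , z<s , ≤-trans (m≤m+n (suc q) m) k≤r ,
                                      ≤+⇒∸≤ next≤ , y<next)) ⟩
    suc q * t              ∎)
    where open ≤-Reasoning

spaced⇒noDivisibleDistance : ∀ {t} .{{_ : NonZero t}} {p r c} → Spaced p r c →
  ∀ {x y h s} → inMuSet t r c x → ¬ inMuSet t r c y → h + y ≡ x →
  t ≤ s → s ≤ t + p → ¬ s ∣ h
spaced⇒noDivisibleDistance spaced x∈S y∉S h+y≡x with gapDistance spaced x∈S y∉S h+y≡x
... | m , lo , hi = noMultipleBetween m lo hi

belowBlock∉S : ∀ {t r c} → (∀ k → 1 ≤ k → k ≤ r → c k < t) →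
  ∀ {k y} → 1 ≤ k → k ≤ r → y + suc (c k) ≡ k * t → ¬ inMuSet t r c y
belowBlock∉S {t} {r} {c} c<t {suc k₀} {y} (s≤s z≤n) k≤r y≡ (k' , 1≤k' , k'≤r , lo , hi)
  with <-cmp k' (suc k₀)
... | tri< k'<k _ _ = contradiction hi (≤⇒≯ (≤-trans (*-monoˡ-≤ t (s≤s⁻¹ k'<k)) prev≤y))
  where
  prev≤y : k₀ * t ≤ y
  prev≤y = +-cancelʳ-≤ (suc (c (suc k₀))) _ _ (begin
    k₀ * t + suc (c (suc k₀))  ≤⟨ +-monoʳ-≤ (k₀ * t) (c<t (suc k₀) z<s k≤r) ⟩
    k₀ * t + t                 ≡⟨ +-comm (k₀ * t) t ⟩
    suc k₀ * t                 ≡⟨ sym y≡ ⟩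
    y + suc (c (suc k₀))       ∎)
    where open ≤-Reasoning
... | tri≈ _ refl _ = contradiction (∸≤⇒≤+ lo)
      (<⇒≱ (subst (y + c k' <_) y≡ (+-monoʳ-< y (n<1+n (c k')))))
... | tri> _ _ k<k' = contradiction (∸≤⇒≤+ lo) (<⇒≱ (begin-strict
      y + c k'              <⟨ +-monoʳ-< y (c<t k' 1≤k' k'≤r) ⟩
      y + t                 ≤⟨ +-monoˡ-≤ t (m≤m+n y (suc (c (suc k₀)))) ⟩
      y + suc (c (suc k₀)) + t ≡⟨ cong (_+ t) y≡ ⟩
      suc k₀ * t + t        ≡⟨ +-comm (suc k₀ * t) t ⟩
      suc (suc k₀) * t      ≤⟨ *-monoˡ-≤ t k<k' ⟩
      k' * t                ∎))
  where open ≤-Reasoning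

-- If the spacing fails at k (c_k < c_{k+1} + p), the number y just below
-- block k and the point h + y of block k+1 with h = t + (c_k + 1 - c_{k+1})
-- are at a distance h ∈ [t, t+p].
spacingFailure⇒distance : ∀ {t p r c} → (∀ k → 1 ≤ k → k ≤ r → 1 ≤ c k × c k < t) →
  ∀ {k} → 1 ≤ k → suc k ≤ r → c k < p + c (suc k) →
  ∃₂ λ y h → t ≤ h × h ≤ t + p × ¬ inMuSet t r c y × inMuSet t r c (h + y)
spacingFailure⇒distance {t} {p} {r} {c} bounds {suc k₀} (s≤s z≤n) k+1≤r fails =
  y , t + u , m≤m+n t u , +-monoʳ-≤ t u≤p ,
  belowBlock∉S (λ k 1≤k k≤r → proj₂ (bounds k 1≤k k≤r)) z<s k≤r y≡ ,
  (suc k , z<s , k+1≤r , ≤+⇒∸≤ lower , upper)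
  where
  open ≤-Reasoning
  k cₖ c' y u : ℕ
  k = suc k₀
  k≤r : k ≤ r
  k≤r = ≤-trans (n≤1+n k) k+1≤r
  cₖ = c k
  c' = c (suc k)
  y = k * t ∸ suc cₖ
  u = suc cₖ ∸ c'
  y≡ : y + suc cₖ ≡ k * t
  y≡ = m∸n+n≡m (≤-trans (proj₂ (bounds k z<s k≤r)) (m≤m+n t (k₀ * t)))
  u≤p : u ≤ p
  u≤p = m≤n+o⇒m∸n≤o (suc cₖ) c' (subst (suc cₖ ≤_) (+-comm p c') fails)
  u≤cₖ : u ≤ cₖ
  u≤cₖ = ∸-monoʳ-≤ (suc cₖ) (proj₁ (bounds (suc k) z<s k+1≤r))
  rearrange : ∀ a b c d → a + (b + (c + d)) ≡ a + d + b + c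
  rearrange = solve-∀
  lower : suc k * t ≤ t + u + y + c'
  lower = begin
    t + k * t              ≡⟨ cong (t +_) (sym y≡) ⟩
    t + (y + suc cₖ)       ≤⟨ +-monoʳ-≤ t (+-monoʳ-≤ y (m≤n+m∸n (suc cₖ) c')) ⟩
    t + (y + (c' + u))     ≡⟨ rearrange t y c' u ⟩
    t + u + y + c'         ∎
  upper : t + u + y < suc k * t
  upper = begin-strict
    t + u + y              ≡⟨ +-assoc t u y ⟩
    t + (u + y)            ≡⟨ cong (t +_) (+-comm u y) ⟩
    t + (y + u)            <⟨ +-monoʳ-< t (+-monoʳ-< y (s≤s u≤cₖ)) ⟩
    t + (y + suc cₖ)       ≡⟨ cong (t +_) y≡ ⟩
    t + k * t              ∎

lemma3p3 : (t p : ℕ) → 1 ≤ t → 1 ≤ p →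
    (r : ℕ) → 1 ≤ r → r ≤ Nbound t p →
    (c : ℕ → ℕ) → (∀ k → 1 ≤ k → k ≤ r → 1 ≤ c k × c k ≤ aSeq t p k) →
    (μ : Partition) → (∀ x → (x ∈β μ) ⇔ inMuSet t r c x) →
    IsCoreRange t p μ ⇔ (∀ k → 1 ≤ k → k ≤ r ∸ 1 → p + c (suc k) ≤ c k)
lemma3p3 (suc t') p _ _ r 1≤r _ c bounds μ β⇔S = mk⇔ core⇒spaced spaced⇒core
  where
  t : ℕ
  t = suc t'
  c<t : ∀ k → 1 ≤ k → k ≤ r → 1 ≤ c k × c k < t
  c<t k 1≤k k≤r = proj₁ (bounds k 1≤k k≤r) ,
    s≤s (≤-trans (proj₂ (bounds k 1≤k k≤r)) (∸-monoˡ-≤ 1 (m∸n≤m t ((k ∸ 1) * p))))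
  toS : ∀ x → x ∈β μ → inMuSet t r c x
  toS x = Equivalence.to (β⇔S x)
  fromS : ∀ x → inMuSet t r c x → x ∈β μ
  fromS x = Equivalence.from (β⇔S x)

  -- In a (t, …, t+p)-core no distance h ∈ [t, t+p] leads from outside S
  -- into S, since by gap-hook it would be a hook length.
  core⇒noDistance : IsCoreRange t p μ → ∀ {y h} → t ≤ h → h ≤ t + p →
    ¬ inMuSet t r c y → ¬ inMuSet t r c (h + y)
  core⇒noDistance core {y} {h} t≤h h≤t+p y∉S h+y∈S =
    let (i , j , j<part , hook≡h) = gap-hook μ (y∉S ∘ toS y) (≤-trans z<s t≤h) (fromS (h + y) h+y∈S)
    in core h t≤h h≤t+p i j j<part (subst (h ∣_) (sym hook≡h) ∣-refl)

  core⇒spaced : IsCoreRange t p μ → Spaced p r c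
  core⇒spaced core k 1≤k k≤r-1 = ≮⇒≥ λ fails →
    let (y , h , t≤h , h≤t+p , y∉S , h+y∈S) = spacingFailure⇒distance c<t 1≤k k+1≤r fails
    in core⇒noDistance core t≤h h≤t+p y∉S h+y∈S
    where
    k+1≤r : suc k ≤ r
    k+1≤r = subst (_≤ r) (+-comm k 1) (m≤o∸n⇒m+n≤o k 1≤r k≤r-1)

  -- Under the spacing every hook is a distance from a gap up to S, hence
  -- not divisible by any s ∈ [t, t+p].
  spaced⇒core : Spaced p r c → IsCoreRange t p μ
  spaced⇒core spaced s t≤s s≤t+p i j j<part =
    let (y , y∉β , x∈β) = hook-gap μ i j j<part
    in spaced⇒noDivisibleDistance spaced (toS (hook μ i j + y) x∈β) (y∉β ∘ fromS y) refl t≤s s≤t+p
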